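{- Let $n$ be a positive integer and let $S$ be a set of cells with an $n$-coloring $\chi$. Then $S$ contains exactly one instance of each $n$-coloring of the square tetromino if and only if $f(S)$, with the induced coloring, contains exactly one instance of each $n$-coloring of the Z tetromino.
   Context: Cells are the unit squares of the square lattice, indexed by integer coordinates $(x,y)$. The row shift is $f(x,y)=(x-y,y)$, applied to sets of cells elementwise; if $S$ has coloring $\chi$, then $f(S)$ gets the induced coloring $\chi'$ with $\chi'(f(c))=\chi(c)$. An $n$-coloring assigns each cell a color in $\{1,\dots,n\}$. An instance of the square tetromino is a set $\{(m,k),(m+1,k),(m,k-1),(m+1,k-1)\}$; an instance of the Z tetromino is a set $\{(x,y),(x+1,y),(x+1,y-1),(x+2,y-1)\}$. An instance contained in a colored set is colored by restriction; two instances of the same shape have the same coloring if the colorings agree under the translation between them. An $n$-coloring of a shape is a coloring of one fixed representative of it, and an instance realizes that coloring if it has the same coloring in this sense. -}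

module Defs where

open import Data.Nat using (ℕ)
open import Data.Integer using (ℤ; _+_; _-_; +_; -[1+_])
open import Data.Fin using (Fin; zero; suc)
open import Data.Product using (Σ; _×_; _,_; ∃!)
open import Relation.Binary.PropositionalEquality using (_≡_)

Cell : Set
Cell = ℤ × ℤ

CellSet : Set₁
CellSet = Cell → Set

Coloring : ℕ → CellSet → Set
Coloring n S = (c : Cell) → S c → Fin n

f : Cell → Cell
f (x , y) = (x - y , y)

fImage : CellSet → CellSet
fImage S d = Σ Cell λ c → S c × f c ≡ d

induced : ∀ {n} (S : CellSet) → Coloring n S → Coloring n (fImage S)
induced S χ d (c , s , _) = χ c s

_⊕_ : Cell → Cell → Cell
(a , b) ⊕ (c , d) = (a + c , b + d)

squareOff : Fin 4 → Cell
squareOff zero = (+ 0 , + 0)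
squareOff (suc zero) = (+ 1 , + 0)
squareOff (suc (suc zero)) = (+ 0 , -[1+ 0 ])
squareOff (suc (suc (suc zero))) = (+ 1 , -[1+ 0 ])

zOff : Fin 4 → Cell
zOff zero = (+ 0 , + 0)
zOff (suc zero) = (+ 1 , + 0)
zOff (suc (suc zero)) = (+ 1 , -[1+ 0 ])
zOff (suc (suc (suc zero))) = (+ 2 , -[1+ 0 ])

-- An n-coloring of a tetromino: a colouring of the four cells of its
-- fixed representative (indexed as in the offset tables above).
ShapeColoring : ℕ → Set
ShapeColoring n = Fin 4 → Fin n

Realizes : ∀ {n} (off : Fin 4 → Cell) (S : CellSet) → Coloring n S →
           ShapeColoring n → Cell → Set
Realizes off S χ p a = (i : Fin 4) → Σ (S (a ⊕ off i)) λ s → χ (a ⊕ off i) s ≡ p i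

-- S contains exactly one instance (identified by its anchor) of the shape
-- realizing each n-coloring of the shape.
ExactlyOneEach : ∀ {n} (off : Fin 4 → Cell) (S : CellSet) → Coloring n S → Set
ExactlyOneEach {n} off S χ = (p : ShapeColoring n) → ∃! _≡_ (Realizes off S χ p)

{-# OPTIONS --safe #-}
-- The row shift f is an additive bijection of the lattice that maps the
-- square tetromino onto the Z tetromino.  Hence an instance of the square
-- at anchor a in S corresponds, colour for colour, to an instance of the Z
-- at anchor f a in f(S), and f is a bijection between the anchors of
-- instances with a given colouring, so unique existence transfers both ways.
module Submission where

open import Defs
open import Data.Nat using (ℕ; NonZero)
open import Data.Integer using (ℤ; _+_; _-_)
open import Data.Integer.Tactic.RingSolver using (solve-∀)
open import Data.Fin using (Fin; zero; suc)
open import Data.Product using (Σ; _×_; _,_; ∃!)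
open import Function using (_⇔_; mk⇔; Equivalence)
open import Relation.Binary.PropositionalEquality
  using (_≡_; refl; sym; trans; cong; subst)

unshift : Cell → Cell
unshift (x , y) = (x + y , y)

unshift-f : ∀ c → unshift (f c) ≡ c
unshift-f (x , y) = cong (_, y) (lemma x y)
  where
  lemma : ∀ (x y : ℤ) → (x - y) + y ≡ x
  lemma = solve-∀

f-unshift : ∀ d → f (unshift d) ≡ d
f-unshift (x , y) = cong (_, y) (lemma x y)
  where
  lemma : ∀ (x y : ℤ) → (x + y) - y ≡ x
  lemma = solve-∀

f-injective : ∀ {c c′} → f c ≡ f c′ → c ≡ c′
f-injective {c} {c′} eq = trans (sym (unshift-f c)) (trans (cong unshift eq) (unshift-f c′))

f-⊕ : ∀ a b → f (a ⊕ b) ≡ f a ⊕ f b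
f-⊕ (x , y) (u , v) = cong (_, y + v) (lemma x y u v)
  where
  lemma : ∀ (x y u v : ℤ) → (x + u) - (y + v) ≡ (x - y) + (u - v)
  lemma = solve-∀

f-squareOff : ∀ i → f (squareOff i) ≡ zOff i
f-squareOff zero                   = refl
f-squareOff (suc zero)             = refl
f-squareOff (suc (suc zero))       = refl
f-squareOff (suc (suc (suc zero))) = refl

∃!-transport : ∀ {A B : Set} {P : A → Set} {Q : B → Set}
  (φ : A → B) (ψ : B → A) → (∀ b → φ (ψ b) ≡ b) →
  (∀ {a} → P a → Q (φ a)) → (∀ {b} → Q b → P (ψ b)) →
  ∃! _≡_ P → ∃! _≡_ Q
∃!-transport φ ψ φψ P⇒Q Q⇒P (a , Pa , unique) =
  φ a , P⇒Q Pa , λ {b} Qb → trans (cong φ (unique (Q⇒P Qb))) (φψ b)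

∃!-cong-bijection : ∀ {A B : Set} {P : A → Set} {Q : B → Set}
  (φ : A → B) (ψ : B → A) → (∀ b → φ (ψ b) ≡ b) → (∀ a → ψ (φ a) ≡ a) →
  (∀ a → P a ⇔ Q (φ a)) → ∃! _≡_ P ⇔ ∃! _≡_ Q
∃!-cong-bijection {P = P} {Q = Q} φ ψ φψ ψφ P⇔Qφ = mk⇔
  (∃!-transport φ ψ φψ (Equivalence.to (P⇔Qφ _)) Q⇒Pψ)
  (∃!-transport ψ φ ψφ Q⇒Pψ (Equivalence.to (P⇔Qφ _)))
  where
  Q⇒Pψ : ∀ {b} → Q b → P (ψ b)
  Q⇒Pψ {b} Qb = Equivalence.from (P⇔Qφ (ψ b)) (subst Q (sym (φψ b)) Qb)

module _ {n : ℕ} (S : CellSet) (χ : Coloring n S)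
         (off off′ : Fin 4 → Cell) (f-off : ∀ i → f (off i) ≡ off′ i) where

  f-shape : ∀ a i → f (a ⊕ off i) ≡ f a ⊕ off′ i
  f-shape a i = trans (f-⊕ a (off i)) (cong (f a ⊕_) (f-off i))

  realizes-f⇔ : ∀ p a →
    Realizes off S χ p a ⇔ Realizes off′ (fImage S) (induced S χ) p (f a)
  realizes-f⇔ p a = mk⇔ to from
    where
    to : Realizes off S χ p a → Realizes off′ (fImage S) (induced S χ) p (f a)
    to r i = let (s , colour) = r i in (a ⊕ off i , s , f-shape a i) , colour

    from : Realizes off′ (fImage S) (induced S χ) p (f a) → Realizes off S χ p a
    from r i =
      let ((c , s , fc≡) , colour) = r i
      in subst (λ c → Σ (S c) λ s → χ c s ≡ p i)
               (f-injective (trans fc≡ (sym (f-shape a i)))) (s , colour)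

  exactlyOneEach-f⇔ :
    ExactlyOneEach off S χ ⇔ ExactlyOneEach off′ (fImage S) (induced S χ)
  exactlyOneEach-f⇔ = mk⇔
    (λ H p → Equivalence.to   (unique p) (H p))
    (λ H p → Equivalence.from (unique p) (H p))
    where
    unique : ∀ p → ∃! _≡_ (Realizes off S χ p)
                 ⇔ ∃! _≡_ (Realizes off′ (fImage S) (induced S χ) p)
    unique p = ∃!-cong-bijection f unshift f-unshift unshift-f (realizes-f⇔ p)

lemma6p3 : (n : ℕ) → NonZero n → (S : CellSet) → (χ : Coloring n S) →
    (ExactlyOneEach squareOff S χ → ExactlyOneEach zOff (fImage S) (induced S χ))
    × (ExactlyOneEach zOff (fImage S) (induced S χ) → ExactlyOneEach squareOff S χ)
lemma6p3 n _ S χ = to , from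
  where open Equivalence (exactlyOneEach-f⇔ S χ squareOff zOff f-squareOff)
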